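{- For each $\epsilon>0$ there exist an infinite subsequence $\omega=(p_{b_j})_{j\ge1}$ ($b_1<b_2<\cdots$) of $p_0,p_1,p_2,\dots$ and a positive integer $K_0'$ such that $t_N(\omega)<K_0'$ for all $N\in\mathbb{Z}_{\ge0}$ and $b_j\ll j^{2+\epsilon}$ (i.e. $b_j\le C j^{2+\epsilon}$ for some constant $C$ and all $j$).
   Context: Let $q=p^s$ be a prime power and $\mathbb{F}_q$ the field with $q$ elements. Fix a bijection $\iota:\{0,1,\dots,q-1\}\to\mathbb{F}_q$ with $\iota(0)=0$. For $N\in\mathbb{Z}_{\ge0}$ with base-$q$ expansion $N=c_0+c_1q+\dots+c_nq^n$ ($0\le c_i<q$), put $p_N=\iota(c_0)+\iota(c_1)T+\dots+\iota(c_n)T^n\in\mathbb{F}_q[T]$; this gives a bijection $\mathbb{Z}_{\ge0}\to\mathbb{F}_q[T]$. For a subsequence $\omega$ of $p_0,p_1,\dots$ write $f\in\omega$ if $f$ occurs in $\omega$, and for $N\ge0$ define $t_N(\omega)=|\{(a,b)\in\mathbb{Z}_{\ge0}^2: p_a,p_b\in\omega,\ p_N=p_a-p_b,\ \deg p_a,\deg p_b\le\deg p_N\}|$, with $\deg 0=-\infty$.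
   Formalization: The parameter ε ranges only over the positive rationals. -}

module Defs where

open import Level using (Level; _⊔_)
open import Algebra.Bundles using (CommutativeRing)
open import Data.Nat using (ℕ; zero; suc; _≤_; _^_; NonZero)
open import Data.Nat.DivMod using (_/_; _mod_)
open import Data.Nat.Primality using (Prime)
open import Data.Fin using (Fin)
import Data.Fin as F
open import Data.Product using (Σ; ∃; _×_; _,_)
open import Relation.Nullary using (¬_)
open import Relation.Binary.PropositionalEquality using (_≡_)
open import Function.Definitions using (Injective)

IsPrimePower : ℕ → Set
IsPrimePower q = ∃ λ p → ∃ λ s → Prime p × 1 ≤ s × q ≡ p ^ s

IsField : ∀ {c ℓ} → CommutativeRing c ℓ → Set (c ⊔ ℓ)
IsField R = ¬ (0# ≈ 1#) × (∀ x → ¬ (x ≈ 0#) → ∃ λ y → x * y ≈ 1#)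
  where open CommutativeRing R

IsDigitBijection : ∀ {c ℓ} (q : ℕ) (R : CommutativeRing c ℓ) → (Fin q → CommutativeRing.Carrier R) → Set (c ⊔ ℓ)
IsDigitBijection q R ι =
    (∀ i j → ι i ≈ ι j → i ≡ j)
  × (∀ x → ∃ λ i → ι i ≈ x)
  × (∀ (z : Fin q) → F.toℕ z ≡ 0 → ι z ≈ 0#)
  where open CommutativeRing R

digit : (q : ℕ) .{{_ : NonZero q}} → ℕ → ℕ → Fin q
digit q N zero    = N mod q
digit q N (suc i) = digit q (N / q) i

-- "There are fewer than K objects (a , b) satisfying P", i.e. the cardinality
-- of {(a,b) | P a b} is < K: no K distinct such pairs exist.
FewerThan : ∀ {ℓ} → ℕ → (ℕ → ℕ → Set ℓ) → Set ℓ
FewerThan K P =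
  ∀ (f : Fin K → ℕ × ℕ) → Injective _≡_ _≡_ f →
  ¬ (∀ k → P (Data.Product.proj₁ (f k)) (Data.Product.proj₂ (f k)))
  where import Data.Product

module Poly {c ℓ} (q : ℕ) .{{_ : NonZero q}} (R : CommutativeRing c ℓ)
            (ι : Fin q → CommutativeRing.Carrier R) where
  open CommutativeRing R

  Pol : Set c
  Pol = ℕ → Carrier

  p : ℕ → Pol
  p N i = ι (digit q N i)

  _≈ₚ_ : Pol → Pol → Set ℓ
  f ≈ₚ g = ∀ i → f i ≈ g i

  _-ₚ_ : Pol → Pol → Pol
  (f -ₚ g) i = f i + (- g i)

  -- deg f ≤ deg g  (deg 0 = -∞): every nonzero coefficient of f sits at or
  -- below some nonzero coefficient of g
  _deg≤_ : Pol → Pol → Set ℓ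
  f deg≤ g = ∀ i → ¬ (f i ≈ 0#) → ∃ λ j → i ≤ j × ¬ (g j ≈ 0#)

  -- the subsequence ω = (p_{b_k})_k is given by its index sequence b;
  -- f ∈ ω iff f = p_a for some a in the range of b
  InSeq : (ℕ → ℕ) → ℕ → Set
  InSeq b a = ∃ λ k → b k ≡ a

  TPair : (ℕ → ℕ) → ℕ → ℕ → ℕ → Set ℓ
  TPair b N a a' = InSeq b a × InSeq b a'
                 × (p N ≈ₚ (p a -ₚ p a'))
                 × (p a deg≤ p N) × (p a' deg≤ p N)

  tLess : (ℕ → ℕ) → ℕ → ℕ → Set ℓ
  tLess b N K = FewerThan K (TPair b N)

-- Level i of the sequence consists of the polynomials of degree 2c_i whose
-- coefficient string is a palindrome 1, t_{c_i - 1}, …, t_0, …, t_{c_i - 1}, 1;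
-- there are q^{c_i} of them, and c_{i+1} ≈ (1 + 1/(2d+1)) c_i keeps
-- b_k^d ≤ q^{3d} (k+1)^{2d+n}.  If p_N = ± (p_x − p_y) with deg p_x, deg p_y
-- ≤ deg p_N, then x and y lie on levels i > j, and i is read off from
-- deg p_N = 2c_i.  For fixed N, sign and j the palindromic symmetries of p_x
-- and p_y force the pair, and two levels j < j′ both far below i (2c_{j′} < c_i)
-- are incompatible.  So a pair is determined by its sign and by i − j when j is
-- close to i, and t_N(ω) ≤ 2 (2d + 2).

module Submission where

open import Defs
open import Algebra.Bundles using (CommutativeRing; Group)
open import Data.Bool using (Bool; true; false)
open import Data.Empty using (⊥; ⊥-elim)
open import Data.Fin using (Fin; toℕ; fromℕ<)
open import Data.Fin.Properties using (toℕ-injective; toℕ<n; toℕ-fromℕ<; pigeonhole)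
open import Data.Nat
open import Data.Nat.DivMod
open import Data.Nat.Divisibility using (divides)
open import Data.Nat.Primality using (prime)
open import Data.Nat.Properties
open import Data.Nat.Solver using (module +-*-Solver)
open import Data.Product using (∃; _×_; _,_; proj₁; proj₂)
open import Data.Sum using (inj₁; inj₂)
open import Relation.Binary.Definitions using (tri<; tri≈; tri>)
open import Relation.Binary.PropositionalEquality
open import Relation.Nullary using (¬_; yes; no)

open +-*-Solver using (solve; _:+_; _:*_; _:=_; con)

module Digits (q : ℕ) .{{_ : NonZero q}} where

  fromDigits : (ℕ → Fin q) → ℕ → ℕ
  fromDigits f zero    = 0
  fromDigits f (suc L) = toℕ (f 0) + fromDigits (λ k → f (suc k)) L * q

  private
    [x+rq]/q≡r : ∀ x r → x < q → (x + r * q) / q ≡ r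
    [x+rq]/q≡r x r x<q = begin
      (x + r * q) / q    ≡⟨ +-distrib-/-∣ʳ x (divides r refl) ⟩
      x / q + r * q / q  ≡⟨ cong₂ _+_ (m<n⇒m/n≡0 x<q) (m*n/n≡m r q) ⟩
      r                  ∎
      where open ≡-Reasoning

    [x+rq]mod-q≡x : ∀ (x : Fin q) r → (toℕ x + r * q) mod q ≡ x
    [x+rq]mod-q≡x x r = toℕ-injective (begin
      toℕ ((toℕ x + r * q) mod q)  ≡⟨ toℕ-fromℕ< (m%n<n (toℕ x + r * q) q) ⟩
      (toℕ x + r * q) % q          ≡⟨ [m+kn]%n≡m%n (toℕ x) r q ⟩
      toℕ x % q                    ≡⟨ m<n⇒m%n≡m (toℕ<n x) ⟩
      toℕ x                        ∎)
      where open ≡-Reasoning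

    digit-0 : ∀ k → toℕ (digit q 0 k) ≡ 0
    digit-0 zero    = trans (toℕ-fromℕ< (m%n<n 0 q)) (m<n⇒m%n≡m (>-nonZero⁻¹ q))
    digit-0 (suc k) rewrite m<n⇒m/n≡0 {0} {q} (>-nonZero⁻¹ q) = digit-0 k

  digit-fromDigits : ∀ f L k → k < L → digit q (fromDigits f L) k ≡ f k
  digit-fromDigits f (suc L) zero    _         = [x+rq]mod-q≡x (f 0) (fromDigits (λ k → f (suc k)) L)
  digit-fromDigits f (suc L) (suc k) (s≤s k<L)
    rewrite [x+rq]/q≡r (toℕ (f 0)) (fromDigits (λ k → f (suc k)) L) (toℕ<n (f 0)) =
    digit-fromDigits (λ k → f (suc k)) L k k<L

  digit-fromDigits-≥ : ∀ f L k → L ≤ k → toℕ (digit q (fromDigits f L) k) ≡ 0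
  digit-fromDigits-≥ f zero    k       _         = digit-0 k
  digit-fromDigits-≥ f (suc L) (suc k) (s≤s L≤k)
    rewrite [x+rq]/q≡r (toℕ (f 0)) (fromDigits (λ k → f (suc k)) L) (toℕ<n (f 0)) =
    digit-fromDigits-≥ (λ k → f (suc k)) L k L≤k

  fromDigits-< : ∀ f L → fromDigits f L < q ^ L
  fromDigits-< f zero    = s≤s z≤n
  fromDigits-< f (suc L) = begin-strict
    toℕ (f 0) + r * q  <⟨ +-monoˡ-< _ (toℕ<n (f 0)) ⟩
    suc r * q          ≤⟨ *-monoˡ-≤ q (fromDigits-< (λ k → f (suc k)) L) ⟩
    q ^ L * q          ≡⟨ *-comm (q ^ L) q ⟩
    q ^ suc L          ∎
    where open ≤-Reasoning
          r = fromDigits (λ k → f (suc k)) L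

  fromDigits-digit : ∀ L t → t < q ^ L → fromDigits (digit q t) L ≡ t
  fromDigits-digit zero    t (s≤s z≤n) = refl
  fromDigits-digit (suc L) t t<q^L+1  = begin
    toℕ (t mod q) + fromDigits (digit q (t / q)) L * q
      ≡⟨ cong₂ (λ a b → a + b * q) (toℕ-fromℕ< (m%n<n t q)) (fromDigits-digit L (t / q) t/q<q^L) ⟩
    t % q + (t / q) * q
      ≡⟨ sym (m≡m%n+[m/n]*n t q) ⟩
    t ∎
    where open ≡-Reasoning
          t/q<q^L = m<n*o⇒m/o<n (subst (t <_) (*-comm q (q ^ L)) t<q^L+1)

  fromDigits-cong : ∀ f g L → (∀ k → k < L → f k ≡ g k) → fromDigits f L ≡ fromDigits g L
  fromDigits-cong f g zero    f≗g = refl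
  fromDigits-cong f g (suc L) f≗g = cong₂ (λ a b → toℕ a + b * q) (f≗g 0 (s≤s z≤n))
    (fromDigits-cong (λ k → f (suc k)) (λ k → g (suc k)) L (λ k k<L → f≗g (suc k) (s≤s k<L)))

  fromDigits-+ : ∀ f L M → fromDigits f (L + M) ≡ fromDigits f L + q ^ L * fromDigits (λ k → f (L + k)) M
  fromDigits-+ f zero    M = sym (+-identityʳ _)
  fromDigits-+ f (suc L) M = begin
    toℕ (f 0) + fromDigits (λ k → f (suc k)) (L + M) * q
      ≡⟨ cong (λ z → toℕ (f 0) + z * q) (fromDigits-+ (λ k → f (suc k)) L M) ⟩
    toℕ (f 0) + (A + q ^ L * B) * q
      ≡⟨ solve 5 (λ a A′ p B′ Q → a :+ (A′ :+ p :* B′) :* Q := (a :+ A′ :* Q) :+ (Q :* p) :* B′)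
               refl (toℕ (f 0)) A (q ^ L) B q ⟩
    (toℕ (f 0) + A * q) + (q * q ^ L) * B ∎
    where open ≡-Reasoning
          A = fromDigits (λ k → f (suc k)) L
          B = fromDigits (λ k → f (suc L + k)) M

  n<q^n : 2 ≤ q → ∀ n → n < q ^ n
  n<q^n 2≤q zero    = s≤s z≤n
  n<q^n 2≤q (suc n) = begin-strict
    suc n          ≤⟨ n<q^n 2≤q n ⟩
    q ^ n          <⟨ m<m+n (q ^ n) (m^n>0 q n) ⟩
    q ^ n + q ^ n  ≡⟨ cong (q ^ n +_) (sym (+-identityʳ (q ^ n))) ⟩
    2 * q ^ n      ≤⟨ *-monoˡ-≤ (q ^ n) 2≤q ⟩
    q ^ suc n      ∎
    where open ≤-Reasoning

  digit-injective : 2 ≤ q → ∀ x y → (∀ k → digit q x k ≡ digit q y k) → x ≡ y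
  digit-injective 2≤q x y x≗y = begin
    x                          ≡⟨ sym (fromDigits-digit (x + y) x (bound x (m≤m+n x y))) ⟩
    fromDigits (digit q x) (x + y) ≡⟨ fromDigits-cong _ _ (x + y) (λ k _ → x≗y k) ⟩
    fromDigits (digit q y) (x + y) ≡⟨ fromDigits-digit (x + y) y (bound y (m≤n+m y x)) ⟩
    y                          ∎
    where open ≡-Reasoning
          bound : ∀ z → z ≤ x + y → z < q ^ (x + y)
          bound z z≤ = <-≤-trans (n<q^n 2≤q z) (^-monoʳ-≤ q z≤)

module Palindromes (q : ℕ) .{{_ : NonZero q}} (2≤q : 2 ≤ q) where
  open Digits q

  oneDigit : Fin q
  oneDigit = fromℕ< 2≤q

  -- The base-q digits of  palindrome c t , from position 0 to 2c, are
  -- 1, t_{c-1}, …, t_1, t_0, t_1, …, t_{c-1}, 1  where t_k = digit q t k.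
  halfDigit : ℕ → ℕ → ℕ → Fin q
  halfDigit c t zero    = oneDigit
  halfDigit c t (suc j) = digit q t (c ∸ suc j)

  palindromeDigit : ℕ → ℕ → ℕ → Fin q
  palindromeDigit c t k = halfDigit c t (k ⊓ (c + c ∸ k))

  palindrome : ℕ → ℕ → ℕ
  palindrome c t = fromDigits (palindromeDigit c t) (suc (c + c))

  digit-palindrome : ∀ c t k → k ≤ c + c → digit q (palindrome c t) k ≡ palindromeDigit c t k
  digit-palindrome c t k k≤2c = digit-fromDigits (palindromeDigit c t) (suc (c + c)) k (s≤s k≤2c)

  digit-palindrome-> : ∀ c t k → c + c < k → toℕ (digit q (palindrome c t) k) ≡ 0
  digit-palindrome-> c t = digit-fromDigits-≥ (palindromeDigit c t) (suc (c + c))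

  digit-palindrome-mirror : ∀ c t k → k ≤ c + c →
                            digit q (palindrome c t) k ≡ digit q (palindrome c t) (c + c ∸ k)
  digit-palindrome-mirror c t k k≤2c = begin
    digit q (palindrome c t) k                    ≡⟨ digit-palindrome c t k k≤2c ⟩
    halfDigit c t (k ⊓ (c + c ∸ k))               ≡⟨ cong (halfDigit c t) (⊓-comm k (c + c ∸ k)) ⟩
    halfDigit c t ((c + c ∸ k) ⊓ k)               ≡⟨ cong (λ z → halfDigit c t ((c + c ∸ k) ⊓ z)) (sym (m∸[m∸n]≡n k≤2c)) ⟩
    halfDigit c t ((c + c ∸ k) ⊓ (c + c ∸ (c + c ∸ k)))
                                                  ≡⟨ sym (digit-palindrome c t (c + c ∸ k) (m∸n≤m (c + c) k)) ⟩
    digit q (palindrome c t) (c + c ∸ k)          ∎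
    where open ≡-Reasoning

  palindromeDigit-top : ∀ c t → palindromeDigit c t (c + c) ≡ oneDigit
  palindromeDigit-top c t rewrite n∸n≡0 (c + c) | ⊓-zeroʳ (c + c) = refl

  digit-palindrome-top : ∀ c t → digit q (palindrome c t) (c + c) ≡ oneDigit
  digit-palindrome-top c t = trans (digit-palindrome c t (c + c) ≤-refl) (palindromeDigit-top c t)

  palindromeDigit-upper : ∀ c t k → k < c → palindromeDigit c t (c + k) ≡ digit q t k
  palindromeDigit-upper c t k k<c = begin
    halfDigit c t ((c + k) ⊓ (c + c ∸ (c + k)))  ≡⟨ cong (λ z → halfDigit c t ((c + k) ⊓ z)) ([m+n]∸[m+o]≡n∸o c c k) ⟩
    halfDigit c t ((c + k) ⊓ (c ∸ k))            ≡⟨ cong (halfDigit c t) (m≥n⇒m⊓n≡n (≤-trans (m∸n≤m c k) (m≤m+n c k))) ⟩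
    halfDigit c t (c ∸ k)                        ≡⟨ halfDigit-∸ ⟩
    digit q t k                                  ∎
    where
      open ≡-Reasoning
      halfDigit-∸ : halfDigit c t (c ∸ k) ≡ digit q t k
      halfDigit-∸ with c ∸ k in c∸k≡
      ... | zero  = ⊥-elim (<⇒≢ (m<n⇒0<n∸m k<c) (sym c∸k≡))
      ... | suc j = cong (digit q t) (trans (cong (c ∸_) (sym c∸k≡)) (m∸[m∸n]≡n (<⇒≤ k<c)))

  palindrome-≡ : ∀ c t → t < q ^ c →
                 palindrome c t ≡ fromDigits (palindromeDigit c t) c + q ^ c * (t + q ^ c)
  palindrome-≡ c t t<q^c = begin
    fromDigits pd (suc (c + c))                      ≡⟨ cong (fromDigits pd) (sym (+-suc c c)) ⟩
    fromDigits pd (c + suc c)                        ≡⟨ fromDigits-+ pd c (suc c) ⟩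
    fromDigits pd c + q ^ c * fromDigits upper (suc c) ≡⟨ cong (λ z → fromDigits pd c + q ^ c * z) upper-value ⟩
    fromDigits pd c + q ^ c * (t + q ^ c)            ∎
    where
      open ≡-Reasoning
      pd = palindromeDigit c t
      upper = λ k → pd (c + k)
      top-value : fromDigits (λ k → upper (c + k)) 1 ≡ 1
      top-value = begin
        toℕ (pd (c + (c + 0))) + 0  ≡⟨ cong (λ z → toℕ (pd (c + z)) + 0) (+-identityʳ c) ⟩
        toℕ (pd (c + c)) + 0        ≡⟨ cong (λ z → toℕ z + 0) (palindromeDigit-top c t) ⟩
        toℕ oneDigit + 0            ≡⟨ cong (_+ 0) (toℕ-fromℕ< 2≤q) ⟩
        1                           ∎
      upper-value : fromDigits upper (suc c) ≡ t + q ^ c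
      upper-value = begin
        fromDigits upper (suc c)                                   ≡⟨ cong (fromDigits upper) (+-comm 1 c) ⟩
        fromDigits upper (c + 1)                                   ≡⟨ fromDigits-+ upper c 1 ⟩
        fromDigits upper c + q ^ c * fromDigits (λ k → upper (c + k)) 1
          ≡⟨ cong₂ (λ a b → a + q ^ c * b)
                   (trans (fromDigits-cong upper (digit q t) c (palindromeDigit-upper c t)) (fromDigits-digit c t t<q^c))
                   top-value ⟩
        t + q ^ c * 1                                              ≡⟨ cong (t +_) (*-identityʳ (q ^ c)) ⟩
        t + q ^ c                                                  ∎

  palindrome-≥ : ∀ c t → t < q ^ c → q ^ c * (t + q ^ c) ≤ palindrome c t
  palindrome-≥ c t t<q^c =
    subst (q ^ c * (t + q ^ c) ≤_) (sym (palindrome-≡ c t t<q^c)) (m≤n+m _ (fromDigits (palindromeDigit c t) c))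

  palindrome-< : ∀ c t → t < q ^ c → palindrome c t < q ^ c * (suc t + q ^ c)
  palindrome-< c t t<q^c = begin-strict
    palindrome c t                                        ≡⟨ palindrome-≡ c t t<q^c ⟩
    fromDigits (palindromeDigit c t) c + q ^ c * (t + q ^ c) <⟨ +-monoˡ-< _ (fromDigits-< (palindromeDigit c t) c) ⟩
    q ^ c + q ^ c * (t + q ^ c)                           ≡⟨ sym (*-suc (q ^ c) (t + q ^ c)) ⟩
    q ^ c * (suc t + q ^ c)                               ∎
    where open ≤-Reasoning

  palindrome-<-suc : ∀ c t → suc t < q ^ c → palindrome c t < palindrome c (suc t)
  palindrome-<-suc c t st<q^c = <-≤-trans (palindrome-< c t (<-trans (n<1+n t) st<q^c)) (palindrome-≥ c (suc t) st<q^c)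

  q^[c+c]≤palindrome : ∀ c t → t < q ^ c → q ^ (c + c) ≤ palindrome c t
  q^[c+c]≤palindrome c t t<q^c = begin
    q ^ (c + c)          ≡⟨ ^-distribˡ-+-* q c c ⟩
    q ^ c * q ^ c        ≤⟨ *-monoʳ-≤ (q ^ c) (m≤n+m (q ^ c) t) ⟩
    q ^ c * (t + q ^ c)  ≤⟨ palindrome-≥ c t t<q^c ⟩
    palindrome c t       ∎
    where open ≤-Reasoning

  palindrome<q^[1+c+c] : ∀ c t → t < q ^ c → palindrome c t < q ^ suc (c + c)
  palindrome<q^[1+c+c] c t t<q^c = begin-strict
    palindrome c t                     <⟨ palindrome-< c t t<q^c ⟩
    q ^ c * (suc t + q ^ c)            ≤⟨ *-monoʳ-≤ (q ^ c) (+-monoˡ-≤ (q ^ c) t<q^c) ⟩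
    q ^ c * (q ^ c + q ^ c)            ≡⟨ cong (λ z → q ^ c * (q ^ c + z)) (sym (+-identityʳ (q ^ c))) ⟩
    q ^ c * (2 * q ^ c)                ≤⟨ *-monoʳ-≤ (q ^ c) (*-monoˡ-≤ (q ^ c) 2≤q) ⟩
    q ^ c * q ^ suc c                  ≡⟨ sym (^-distribˡ-+-* q c (suc c)) ⟩
    q ^ (c + suc c)                    ≡⟨ cong (q ^_) (+-suc c c) ⟩
    q ^ suc (c + c)                    ∎
    where open ≤-Reasoning

-- The half-degree grows by a factor of about 1 + 1/(e+1) per level: fast
-- enough to double within e + 2 levels (halfDegree-far), slow enough to keep
-- the elements of the sequence small (halfDegree-suc-≤).
module HalfDegrees (e : ℕ) where

  halfDegree : ℕ → ℕ
  halfDegree zero    = 1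
  halfDegree (suc i) = halfDegree i + halfDegree i / suc e + 1

  halfDegree-<-suc : ∀ i → halfDegree i < halfDegree (suc i)
  halfDegree-<-suc i = subst (halfDegree i <_) (+-comm 1 (halfDegree i + halfDegree i / suc e))
                             (s≤s (m≤m+n (halfDegree i) _))

  halfDegree-mono-< : ∀ {i j} → i < j → halfDegree i < halfDegree j
  halfDegree-mono-< {i} {suc j} (s≤s i≤j) with m≤n⇒m<n∨m≡n i≤j
  ... | inj₁ i<j  = <-trans (halfDegree-mono-< i<j) (halfDegree-<-suc j)
  ... | inj₂ refl = halfDegree-<-suc j

  halfDegree-mono-≤ : ∀ {i j} → i ≤ j → halfDegree i ≤ halfDegree j
  halfDegree-mono-≤ i≤j with m≤n⇒m<n∨m≡n i≤j
  ... | inj₁ i<j  = <⇒≤ (halfDegree-mono-< i<j)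
  ... | inj₂ refl = ≤-refl

  halfDegree-+ : ∀ j m → halfDegree j + m * (halfDegree j / suc e + 1) ≤ halfDegree (j + m)
  halfDegree-+ j zero    = subst (_≤ halfDegree (j + 0)) (sym (+-identityʳ (halfDegree j)))
                                 (halfDegree-mono-≤ (m≤m+n j 0))
  halfDegree-+ j (suc m) = begin
    c + (s + m * s)                        ≡⟨ solve 3 (λ a b c → a :+ (b :+ c) := (a :+ c) :+ b) refl c s (m * s) ⟩
    (c + m * s) + s                        ≤⟨ +-mono-≤ (halfDegree-+ j m)
                                                       (+-monoˡ-≤ 1 (/-monoˡ-≤ (suc e) (halfDegree-mono-≤ (m≤m+n j m)))) ⟩
    c′ + (c′ / suc e + 1)                  ≡⟨ sym (+-assoc c′ _ 1) ⟩
    halfDegree (suc (j + m))               ≡⟨ cong halfDegree (sym (+-suc j m)) ⟩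
    halfDegree (j + suc m)                 ∎
    where open ≤-Reasoning
          c  = halfDegree j
          s  = c / suc e + 1
          c′ = halfDegree (j + m)

  halfDegree-far : ∀ {j i} → j + suc e < i → halfDegree j + halfDegree j < halfDegree i
  halfDegree-far {j} {i} j+e+1<i = begin-strict
    c + c                          <⟨ +-monoʳ-< c c<[e+1][c/[e+1]+1] ⟩
    c + suc e * (c / suc e + 1)    ≤⟨ halfDegree-+ j (suc e) ⟩
    halfDegree (j + suc e)         ≤⟨ halfDegree-mono-≤ (<⇒≤ j+e+1<i) ⟩
    halfDegree i                   ∎
    where
      open ≤-Reasoning
      c = halfDegree j
      c<[e+1][c/[e+1]+1] : c < suc e * (c / suc e + 1)
      c<[e+1][c/[e+1]+1] = begin-strict
        c                              ≡⟨ m≡m%n+[m/n]*n c (suc e) ⟩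
        c % suc e + (c / suc e) * suc e <⟨ +-monoˡ-< _ (m%n<n c (suc e)) ⟩
        suc e + (c / suc e) * suc e    ≡⟨ solve 2 (λ a b → a :+ b :* a := a :* (b :+ con 1)) refl (suc e) (c / suc e) ⟩
        suc e * (c / suc e + 1)        ∎

  degree : ℕ → ℕ
  degree i = halfDegree i + halfDegree i

  degree-mono-< : ∀ {i j} → i < j → degree i < degree j
  degree-mono-< i<j = +-mono-< (halfDegree-mono-< i<j) (halfDegree-mono-< i<j)

  degree-far : ∀ {j i} → j + suc e < i → degree j + degree j < degree i
  degree-far j+e+1<i = +-mono-< (halfDegree-far j+e+1<i) (halfDegree-far j+e+1<i)

  halfDegree-suc-≤ : ∀ i → e * halfDegree (suc i) ≤ suc e * halfDegree i + e
  halfDegree-suc-≤ i = begin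
    e * (c + c / suc e + 1)          ≡⟨ solve 3 (λ E a b → E :* (a :+ b :+ con 1) := E :* a :+ E :* b :+ E) refl e c (c / suc e) ⟩
    e * c + e * (c / suc e) + e      ≤⟨ +-monoˡ-≤ e (+-monoʳ-≤ (e * c) e*[c/[e+1]]≤c) ⟩
    e * c + c + e                    ≡⟨ cong (_+ e) (+-comm (e * c) c) ⟩
    suc e * c + e                    ∎
    where
      open ≤-Reasoning
      c = halfDegree i
      e*[c/[e+1]]≤c : e * (c / suc e) ≤ c
      e*[c/[e+1]]≤c = ≤-trans (*-monoˡ-≤ (c / suc e) (n≤1+n e))
                              (subst (_≤ c) (*-comm (c / suc e) (suc e)) (m/n*n≤m c (suc e)))

module Sequence (q : ℕ) .{{_ : NonZero q}} (2≤q : 2 ≤ q) (e : ℕ) where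
  open Palindromes q 2≤q
  open HalfDegrees e

  levelSize : ℕ → ℕ
  levelSize i = q ^ halfDegree i

  -- Level i lists the palindromes of half-degree  halfDegree i  in increasing
  -- order; position k = (i , t) says that the k-th element is the t-th of level i.
  next : ℕ × ℕ → ℕ × ℕ
  next (i , t) with suc t <? levelSize i
  ... | yes _ = i , suc t
  ... | no  _ = suc i , 0

  position : ℕ → ℕ × ℕ
  position zero    = 0 , 0
  position (suc k) = next (position k)

  level : ℕ → ℕ
  level k = proj₁ (position k)

  index : ℕ → ℕ
  index k = proj₂ (position k)

  b : ℕ → ℕ
  b k = palindrome (halfDegree (level k)) (index k)

  PositionInvariant : ℕ → ℕ × ℕ → Set
  PositionInvariant k (i , t) = t < levelSize i × t ≤ k × (∀ i′ → i ≡ suc i′ → levelSize i′ ≤ k)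

  position-invariant : ∀ k → PositionInvariant k (position k)
  position-invariant zero = m^n>0 q 1 , z≤n , λ _ ()
  position-invariant (suc k) with position k | position-invariant k
  ... | (i , t) | (t<size , t≤k , previous≤k) with suc t <? levelSize i
  ... | yes t+1<size = t+1<size , s≤s t≤k , λ i′ eq → ≤-trans (previous≤k i′ eq) (n≤1+n k)
  ... | no  t+1≮size = m^n>0 q (halfDegree (suc i)) , z≤n , λ { i′ refl → ≤-trans (≮⇒≥ t+1≮size) (s≤s t≤k) }

  b-strictlyIncreasing : ∀ k → b k < b (suc k)
  b-strictlyIncreasing k with position k | position-invariant k
  ... | (i , t) | (t<size , _ , _) with suc t <? levelSize i
  ... | yes t+1<size = palindrome-<-suc (halfDegree i) t t+1<size
  ... | no  _        = begin-strict
    palindrome c t       <⟨ palindrome<q^[1+c+c] c t t<size ⟩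
    q ^ suc (c + c)      ≤⟨ ^-monoʳ-≤ q (+-mono-≤ (halfDegree-<-suc i) (<⇒≤ (halfDegree-<-suc i))) ⟩
    q ^ (c′ + c′)        ≤⟨ q^[c+c]≤palindrome c′ 0 (m^n>0 q c′) ⟩
    palindrome c′ 0      ∎
    where open ≤-Reasoning
          c  = halfDegree i
          c′ = halfDegree (suc i)

module Growth (q : ℕ) .{{_ : NonZero q}} (2≤q : 2 ≤ q) (d n : ℕ) (1≤n : 1 ≤ n) where
  open Palindromes q 2≤q
  open HalfDegrees (2 * d)
  open Sequence q 2≤q (2 * d)

  exponent-suc-≤ : ∀ i → suc (halfDegree (suc i) + halfDegree (suc i)) * d ≤ 3 * d + (2 * d + n) * halfDegree i
  exponent-suc-≤ i = begin
    suc (c′ + c′) * d           ≡⟨ solve 2 (λ C D → (con 1 :+ (C :+ C)) :* D := D :+ (con 2 :* D) :* C) refl c′ d ⟩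
    d + (2 * d) * c′            ≤⟨ +-monoʳ-≤ d (halfDegree-suc-≤ i) ⟩
    d + (suc (2 * d) * c + 2 * d)
      ≡⟨ solve 2 (λ D C → D :+ ((con 1 :+ con 2 :* D) :* C :+ con 2 :* D) := con 3 :* D :+ (con 2 :* D :+ con 1) :* C) refl d c ⟩
    3 * d + (2 * d + 1) * c     ≤⟨ +-monoʳ-≤ (3 * d) (*-monoˡ-≤ c (+-monoʳ-≤ (2 * d) 1≤n)) ⟩
    3 * d + (2 * d + n) * c     ∎
    where open ≤-Reasoning
          c  = halfDegree i
          c′ = halfDegree (suc i)

  q^[[1+2c]d]≤ : ∀ k i → (∀ i′ → i ≡ suc i′ → levelSize i′ ≤ k) →
                 q ^ (suc (halfDegree i + halfDegree i) * d) ≤ q ^ (3 * d) * suc k ^ (2 * d + n)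
  q^[[1+2c]d]≤ k zero    _          = begin
    q ^ (3 * d)                          ≡⟨ sym (*-identityʳ _) ⟩
    q ^ (3 * d) * 1                      ≤⟨ *-monoʳ-≤ (q ^ (3 * d)) (m^n>0 (suc k) (2 * d + n)) ⟩
    q ^ (3 * d) * suc k ^ (2 * d + n)    ∎
    where open ≤-Reasoning
  q^[[1+2c]d]≤ k (suc i) previous≤k = begin
    q ^ (suc (halfDegree (suc i) + halfDegree (suc i)) * d)
                                         ≤⟨ ^-monoʳ-≤ q (exponent-suc-≤ i) ⟩
    q ^ (3 * d + (2 * d + n) * c)        ≡⟨ ^-distribˡ-+-* q (3 * d) _ ⟩
    q ^ (3 * d) * q ^ ((2 * d + n) * c)  ≡⟨ cong (λ z → q ^ (3 * d) * q ^ z) (*-comm (2 * d + n) c) ⟩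
    q ^ (3 * d) * q ^ (c * (2 * d + n))  ≡⟨ cong (q ^ (3 * d) *_) (sym (^-*-assoc q c (2 * d + n))) ⟩
    q ^ (3 * d) * levelSize i ^ (2 * d + n)
                                         ≤⟨ *-monoʳ-≤ (q ^ (3 * d)) (^-monoˡ-≤ (2 * d + n) (≤-trans (previous≤k i refl) (n≤1+n k))) ⟩
    q ^ (3 * d) * suc k ^ (2 * d + n)    ∎
    where open ≤-Reasoning
          c = halfDegree i

  b^d≤ : ∀ k → b k ^ d ≤ q ^ (3 * d) * suc k ^ (2 * d + n)
  b^d≤ k with position k | position-invariant k
  ... | (i , t) | (t<size , _ , previous≤k) = begin
    palindrome c t ^ d              ≤⟨ ^-monoˡ-≤ d (<⇒≤ (palindrome<q^[1+c+c] c t t<size)) ⟩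
    (q ^ suc (c + c)) ^ d           ≡⟨ ^-*-assoc q (suc (c + c)) d ⟩
    q ^ (suc (c + c) * d)           ≤⟨ q^[[1+2c]d]≤ k i previous≤k ⟩
    q ^ (3 * d) * suc k ^ (2 * d + n) ∎
    where open ≤-Reasoning
          c = halfDegree i

module Differences {c ℓ} (G : Group c ℓ) where
  open Group G hiding (refl; sym; trans)
  open Group G using () renaming (refl to ≈-refl; sym to ≈-sym; trans to ≈-trans)
  open import Algebra.Properties.Group G using (∙-cancelˡ; ∙-cancelʳ; ⁻¹-injective)

  difference : Bool → Carrier → Carrier → Carrier
  difference true  u v = u ∙ v ⁻¹
  difference false u v = v ∙ u ⁻¹

  private
    ∙⁻¹-cancelˡ : ∀ {u v u′ v′} → u ∙ v ⁻¹ ≈ u′ ∙ v′ ⁻¹ → u ≈ u′ → v ≈ v′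
    ∙⁻¹-cancelˡ {u} {v} {u′} {v′} eq u≈u′ =
      ⁻¹-injective (∙-cancelˡ u (v ⁻¹) (v′ ⁻¹) (≈-trans eq (∙-congʳ (≈-sym u≈u′))))

    ∙⁻¹-cancelʳ : ∀ {u v u′ v′} → u ∙ v ⁻¹ ≈ u′ ∙ v′ ⁻¹ → v ≈ v′ → u ≈ u′
    ∙⁻¹-cancelʳ {u} {v} {u′} {v′} eq v≈v′ = ∙-cancelʳ (v ⁻¹) u u′ (≈-trans eq (∙-congˡ (⁻¹-cong (≈-sym v≈v′))))

  difference-injective : ∀ o {u v u′ v′} → difference o u v ≈ difference o u′ v′ →
                         (u ≈ u′ → v ≈ v′) × (v ≈ v′ → u ≈ u′)
  difference-injective true  eq = ∙⁻¹-cancelˡ eq , ∙⁻¹-cancelʳ eq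
  difference-injective false eq = ∙⁻¹-cancelʳ eq , ∙⁻¹-cancelˡ eq

  difference-≈ε : ∀ o {u v} → u ≈ v → difference o u v ≈ ε
  difference-≈ε true  {u} u≈v = ≈-trans (∙-congˡ (⁻¹-cong (≈-sym u≈v))) (inverseʳ u)
  difference-≈ε false {v = v} u≈v = ≈-trans (∙-congˡ (⁻¹-cong u≈v)) (inverseʳ v)

  difference-≈ε⇒≈ : ∀ o {u v} → difference o u v ≈ ε → u ≈ v
  difference-≈ε⇒≈ o {v = v} d≈ε =
    proj₂ (difference-injective o (≈-trans d≈ε (≈-sym (difference-≈ε o (≈-refl {v}))))) ≈-refl

fewerThan-byCode : ∀ {ℓ} {P : ℕ → ℕ → Set ℓ} m (code : ∀ {a b} → P a b → ℕ) →
                   (∀ {a b} (u : P a b) → code u < m) →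
                   (∀ {a b a′ b′} (u : P a b) (v : P a′ b′) → code u ≡ code v → (a , b) ≡ (a′ , b′)) →
                   FewerThan (suc m) P
fewerThan-byCode m code code<m code-injective f f-injective all-P
  with pigeonhole (n<1+n m) (λ k → fromℕ< (code<m (all-P k)))
... | u , v , u<v , same-code = <⇒≢ u<v (cong toℕ (f-injective (code-injective (all-P u) (all-P v) code-u≡code-v)))
  where
    code-u≡code-v = trans (sym (toℕ-fromℕ< (code<m (all-P u))))
                          (trans (cong toℕ same-code) (toℕ-fromℕ< (code<m (all-P v))))

module Representations (q : ℕ) .{{_ : NonZero q}} (2≤q : 2 ≤ q)
    {c ℓ} (R : CommutativeRing c ℓ) (ι : Fin q → CommutativeRing.Carrier R)
    (ι-injective : ∀ i j → CommutativeRing._≈_ R (ι i) (ι j) → i ≡ j)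
    (ι-zero : ∀ (z : Fin q) → toℕ z ≡ 0 → CommutativeRing._≈_ R (ι z) (CommutativeRing.0# R))
    (e : ℕ) where
  open Digits q
  open Palindromes q 2≤q
  open HalfDegrees e
  open Sequence q 2≤q e
  open CommutativeRing R using (_≈_; 0#; +-group)
    renaming (refl to ≈-refl; sym to ≈-sym; trans to ≈-trans; reflexive to ≈-reflexive)
  open Differences +-group
  open Poly q R ι using (p; _deg≤_; TPair; tLess)

  record OnLevel (i x : ℕ) : Set where
    constructor onLevel
    field
      rank     : ℕ
      x≡palindrome : x ≡ palindrome (halfDegree i) rank

  b-onLevel : ∀ k → OnLevel (level k) (b k)
  b-onLevel k = onLevel (index k) refl

  p-onLevel-> : ∀ {i x m} → OnLevel i x → degree i < m → p x m ≈ 0#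
  p-onLevel-> {i} {m = m} (onLevel t refl) deg<m = ι-zero _ (digit-palindrome-> (halfDegree i) t m deg<m)

  p-onLevel-top : ∀ {i x} → OnLevel i x → p x (degree i) ≈ ι oneDigit
  p-onLevel-top {i} (onLevel t refl) = ≈-reflexive (cong ι (digit-palindrome-top (halfDegree i) t))

  p-onLevel-mirror : ∀ {i x m} → OnLevel i x → m ≤ degree i → p x m ≈ p x (degree i ∸ m)
  p-onLevel-mirror {i} {m = m} (onLevel t refl) m≤deg =
    ≈-reflexive (cong ι (digit-palindrome-mirror (halfDegree i) t m m≤deg))

  ι-one≉0 : ¬ (ι oneDigit ≈ 0#)
  ι-one≉0 ι1≈0 = 1≢0 (begin
    1                ≡⟨ sym (toℕ-fromℕ< 2≤q) ⟩
    toℕ oneDigit     ≡⟨ cong toℕ (ι-injective oneDigit zeroDigit (≈-trans ι1≈0 (≈-sym (ι-zero zeroDigit toℕ-zeroDigit)))) ⟩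
    toℕ zeroDigit    ≡⟨ toℕ-zeroDigit ⟩
    0                ∎)
    where
      open ≡-Reasoning
      zeroDigit = fromℕ< (>-nonZero⁻¹ q)
      toℕ-zeroDigit = toℕ-fromℕ< (>-nonZero⁻¹ q)
      1≢0 : ¬ (1 ≡ 0)
      1≢0 ()

  p-injective : ∀ {x x′} → (∀ m → p x m ≈ p x′ m) → x ≡ x′
  p-injective {x} {x′} p≈ = digit-injective 2≤q x x′ (λ m → ι-injective _ _ (p≈ m))

  agree-mirror : ∀ {i x x′ m} → OnLevel i x → OnLevel i x′ → m ≤ degree i →
                 p x (degree i ∸ m) ≈ p x′ (degree i ∸ m) → p x m ≈ p x′ m
  agree-mirror x∈i x′∈i m≤deg agree =
    ≈-trans (p-onLevel-mirror x∈i m≤deg) (≈-trans agree (≈-sym (p-onLevel-mirror x′∈i m≤deg)))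

  -- What  p x − p y ≈ p x′ − p y′  says coefficientwise.
  Coupled : ℕ → ℕ → ℕ → ℕ → Set ℓ
  Coupled x x′ y y′ = ∀ m → (p x m ≈ p x′ m → p y m ≈ p y′ m) × (p y m ≈ p y′ m → p x m ≈ p x′ m)

  coupled-sym : ∀ {x x′ y y′} → Coupled x x′ y y′ → Coupled x′ x y′ y
  coupled-sym coupled m = (λ eq → ≈-sym (proj₁ (coupled m) (≈-sym eq)))
                        , (λ eq → ≈-sym (proj₂ (coupled m) (≈-sym eq)))

  -- Mirroring position m of y (through y's palindrome symmetry, then x's)
  -- lands at  degree i − degree j + m > m,  so downward induction on m works.
  coupled-sameLevel : ∀ {i j x x′ y y′} → OnLevel i x → OnLevel i x′ → OnLevel j y → OnLevel j y′ →
                      j < i → Coupled x x′ y y′ → ∀ m → p y m ≈ p y′ m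
  coupled-sameLevel {i} {j} {x} {x′} {y} {y′} x∈i x′∈i y∈j y′∈j j<i coupled m =
    agree (suc (degree j)) m (<-≤-trans (n<1+n (degree j)) (m≤n+m _ m))
    where
      agree : ∀ f m → degree j < m + f → p y m ≈ p y′ m
      agree f m _ with degree j <? m
      agree f       m _         | yes deg<m = ≈-trans (p-onLevel-> y∈j deg<m) (≈-sym (p-onLevel-> y′∈j deg<m))
      agree zero    m deg<m+0   | no  deg≮m = ⊥-elim (deg≮m (subst (degree j <_) (+-identityʳ m) deg<m+0))
      agree (suc f) m deg<m+f+1 | no  deg≮m = agree-mirror y∈j y′∈j m≤deg (proj₁ (coupled u) x-u)
        where
          m≤deg = ≮⇒≥ deg≮m
          u = degree j ∸ m
          u≤deg-i : u ≤ degree i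
          u≤deg-i = ≤-trans (m∸n≤m (degree j) m) (<⇒≤ (degree-mono-< j<i))
          m<deg-i∸u : m < degree i ∸ u
          m<deg-i∸u = m+n≤o⇒m≤o∸n (suc m) (subst (_< degree i) (sym (m+[n∸m]≡n m≤deg)) (degree-mono-< j<i))
          y-m′ : p y (degree i ∸ u) ≈ p y′ (degree i ∸ u)
          y-m′ = agree f (degree i ∸ u)
                   (<-≤-trans (subst (degree j <_) (+-suc m f) deg<m+f+1) (+-monoˡ-≤ f m<deg-i∸u))
          x-u : p x u ≈ p x′ u
          x-u = agree-mirror x∈i x′∈i u≤deg-i (proj₂ (coupled (degree i ∸ u)) y-m′)

  -- At position  degree i − degree j′  both y and y′ vanish, so x and x′ agree
  -- there and, mirrored, at  degree j′ , where y′ has its leading 1 but y is 0.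
  coupled-farLevels : ∀ {i j j′ x x′ y y′} → OnLevel i x → OnLevel i x′ → OnLevel j y → OnLevel j′ y′ →
                      j < j′ → degree j′ + degree j′ < degree i → ¬ Coupled x x′ y y′
  coupled-farLevels {i} {j} {j′} {x} {x′} {y} {y′} x∈i x′∈i y∈j y′∈j′ j<j′ far coupled =
    ι-one≉0 (≈-trans (≈-sym (p-onLevel-top y′∈j′)) (≈-trans (≈-sym y-top) (p-onLevel-> y∈j (degree-mono-< j<j′))))
    where
      m₀ = degree i ∸ degree j′
      deg-j′<m₀ : degree j′ < m₀
      deg-j′<m₀ = m+n≤o⇒m≤o∸n (suc (degree j′)) far
      y-m₀ : p y m₀ ≈ p y′ m₀
      y-m₀ = ≈-trans (p-onLevel-> y∈j (<-trans (degree-mono-< j<j′) deg-j′<m₀)) (≈-sym (p-onLevel-> y′∈j′ deg-j′<m₀))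
      x-top : p x (degree j′) ≈ p x′ (degree j′)
      x-top = agree-mirror x∈i x′∈i (≤-trans (m≤m+n (degree j′) (degree j′)) (<⇒≤ far)) (proj₂ (coupled m₀) y-m₀)
      y-top : p y (degree j′) ≈ p y′ (degree j′)
      y-top = proj₁ (coupled (degree j′)) x-top

  orient : Bool → ℕ → ℕ → ℕ × ℕ
  orient true  x y = x , y
  orient false x y = y , x

  record Splitting (N a a′ : ℕ) : Set ℓ where
    constructor splitting
    field
      sign  : Bool
      x y i j : ℕ
      j<i   : j < i
      x∈i   : OnLevel i x
      y∈j   : OnLevel j y
      pair≡ : (a , a′) ≡ orient sign x y
      p-N≈  : ∀ m → p N m ≈ difference sign (p x m) (p y m)

  open Splitting

  p-N-> : ∀ {N a a′} (S : Splitting N a a′) → ∀ {m} → degree (i S) < m → p N m ≈ 0#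
  p-N-> S {m} deg<m = ≈-trans (p-N≈ S m) (difference-≈ε (sign S)
    (≈-trans (p-onLevel-> (x∈i S) deg<m) (≈-sym (p-onLevel-> (y∈j S) (<-trans (degree-mono-< (j<i S)) deg<m)))))

  p-N-top≉0 : ∀ {N a a′} (S : Splitting N a a′) → ¬ (p N (degree (i S)) ≈ 0#)
  p-N-top≉0 S p-N-top≈0 = ι-one≉0 (≈-trans (≈-sym (p-onLevel-top (x∈i S)))
    (≈-trans (difference-≈ε⇒≈ (sign S) (≈-trans (≈-sym (p-N≈ S (degree (i S)))) p-N-top≈0))
             (p-onLevel-> (y∈j S) (degree-mono-< (j<i S)))))

  splitting-level≡ : ∀ {N a a′ b b′} (S : Splitting N a a′) (S′ : Splitting N b b′) → i S ≡ i S′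
  splitting-level≡ S S′ with <-cmp (i S) (i S′)
  ... | tri≈ _ i≡i′ _ = i≡i′
  ... | tri< i<i′ _ _ = ⊥-elim (p-N-top≉0 S′ (p-N-> S (degree-mono-< i<i′)))
  ... | tri> _ _ i′<i = ⊥-elim (p-N-top≉0 S (p-N-> S′ (degree-mono-< i′<i)))

  -- Two elements of one level share their leading coefficient, which would cancel in p_N.
  sameLevel-impossible : ∀ {l N a a′} → OnLevel l a → OnLevel l a′ →
                         (∀ m → p N m ≈ difference true (p a m) (p a′ m)) → ¬ (p a deg≤ p N)
  sameLevel-impossible {l} a∈l a′∈l p-N≈ a≤N
    with a≤N (degree l) (λ top≈0 → ι-one≉0 (≈-trans (≈-sym (p-onLevel-top a∈l)) top≈0))
  ... | m , deg≤m , p-N-m≉0 with m≤n⇒m<n∨m≡n deg≤m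
  ... | inj₁ deg<m  = p-N-m≉0 (≈-trans (p-N≈ m) (difference-≈ε true
                        (≈-trans (p-onLevel-> a∈l deg<m) (≈-sym (p-onLevel-> a′∈l deg<m)))))
  ... | inj₂ refl   = p-N-m≉0 (≈-trans (p-N≈ m) (difference-≈ε true
                        (≈-trans (p-onLevel-top a∈l) (≈-sym (p-onLevel-top a′∈l)))))

  toSplitting : ∀ {N a a′} → TPair b N a a′ → Splitting N a a′
  toSplitting ((k , refl) , (k′ , refl) , p-N≈ , a≤N , _) with <-cmp (level k) (level k′)
  ... | tri> _ _ k′<k = splitting true  _ _ _ _ k′<k (b-onLevel k) (b-onLevel k′) refl p-N≈
  ... | tri< k<k′ _ _ = splitting false _ _ _ _ k<k′ (b-onLevel k′) (b-onLevel k) refl p-N≈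
  ... | tri≈ _ k≡k′ _ = ⊥-elim (sameLevel-impossible (b-onLevel k)
                          (subst (λ l → OnLevel l (b k′)) (sym k≡k′) (b-onLevel k′)) p-N≈ a≤N)

  gapCode : ℕ → ℕ → ℕ
  gapCode i j with j + suc e <? i
  ... | yes _ = 0
  ... | no  _ = i ∸ j

  gapCode-≤ : ∀ i j → gapCode i j ≤ suc e
  gapCode-≤ i j with j + suc e <? i
  ... | yes _    = z≤n
  ... | no  near = m≤n+o⇒m∸n≤o i j (≮⇒≥ near)

  gapCode-far : ∀ {i j j′} → j < j′ → j′ < i → gapCode i j ≡ gapCode i j′ → j′ + suc e < i
  gapCode-far {i} {j} {j′} j<j′ j′<i same with j + suc e <? i | j′ + suc e <? i
  ... | _     | yes far = far
  ... | yes _ | no  _   = ⊥-elim (<⇒≢ (m<n⇒0<n∸m j′<i) same)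
  ... | no  _ | no  _   = ⊥-elim (<⇒≢ j<j′ (∸-cancelˡ-≡ (<⇒≤ (<-trans j<j′ j′<i)) (<⇒≤ j′<i) same))

  coupled-sameGap : ∀ {i j j′ x x′ y y′} → OnLevel i x → OnLevel i x′ → OnLevel j y → OnLevel j′ y′ →
                    j < i → j′ < i → gapCode i j ≡ gapCode i j′ → Coupled x x′ y y′ → x ≡ x′ × y ≡ y′
  coupled-sameGap {j = j} {j′} x∈i x′∈i y∈j y′∈j′ j<i j′<i same coupled with <-cmp j j′
  ... | tri≈ _ refl _ = p-injective (λ m → proj₂ (coupled m) (y≈y′ m)) , p-injective y≈y′
    where y≈y′ = coupled-sameLevel x∈i x′∈i y∈j y′∈j′ j<i coupled
  ... | tri< j<j′ _ _ = ⊥-elim (coupled-farLevels x∈i x′∈i y∈j y′∈j′ j<j′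
                          (degree-far (gapCode-far j<j′ j′<i same)) coupled)
  ... | tri> _ _ j′<j = ⊥-elim (coupled-farLevels x′∈i x∈i y′∈j′ y∈j j′<j
                          (degree-far (gapCode-far j′<j j<i (sym same))) (coupled-sym coupled))

  code : ∀ {N a a′} → Splitting N a a′ → ℕ
  code S with sign S
  ... | true  = gapCode (i S) (j S)
  ... | false = suc (suc e) + gapCode (i S) (j S)

  code< : ∀ {N a a′} (S : Splitting N a a′) → code S < suc (suc e) + suc (suc e)
  code< S with sign S
  ... | true  = ≤-trans (s≤s (gapCode-≤ (i S) (j S))) (m≤m+n (suc (suc e)) _)
  ... | false = +-monoʳ-< (suc (suc e)) (s≤s (gapCode-≤ (i S) (j S)))

  coupled-fromDifferences : ∀ o {N x x′ y y′} → (∀ m → p N m ≈ difference o (p x m) (p y m)) →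
                            (∀ m → p N m ≈ difference o (p x′ m) (p y′ m)) → Coupled x x′ y y′
  coupled-fromDifferences o p-N≈ p-N≈′ m = difference-injective o (≈-trans (≈-sym (p-N≈ m)) (p-N≈′ m))

  code-injective : ∀ {N a a′ c c′} (S : Splitting N a a′) (S′ : Splitting N c c′) →
                   code S ≡ code S′ → (a , a′) ≡ (c , c′)
  code-injective S S′ = sameLevel-injective S S′ (splitting-level≡ S S′)
    where
      gapCode≢offset : ∀ i j n → ¬ (gapCode i j ≡ suc (suc e) + n)
      gapCode≢offset i j n = <⇒≢ (≤-trans (s≤s (gapCode-≤ i j)) (m≤m+n (suc (suc e)) _))

      sameLevel-injective : ∀ {N a a′ c c′} (S : Splitting N a a′) (S′ : Splitting N c c′) →
                            i S ≡ i S′ → code S ≡ code S′ → (a , a′) ≡ (c , c′)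
      sameLevel-injective (splitting true x y i j j<i x∈i y∈j pair≡ p-N≈)
                          (splitting true x′ y′ .(i) j′ j′<i x′∈i y′∈j′ pair≡′ p-N≈′) refl same
        with coupled-sameGap x∈i x′∈i y∈j y′∈j′ j<i j′<i same (coupled-fromDifferences true p-N≈ p-N≈′)
      ... | refl , refl = trans pair≡ (sym pair≡′)
      sameLevel-injective (splitting false x y i j j<i x∈i y∈j pair≡ p-N≈)
                          (splitting false x′ y′ .(i) j′ j′<i x′∈i y′∈j′ pair≡′ p-N≈′) refl same
        with coupled-sameGap x∈i x′∈i y∈j y′∈j′ j<i j′<i (+-cancelˡ-≡ (suc (suc e)) _ _ same)
                             (coupled-fromDifferences false p-N≈ p-N≈′)
      ... | refl , refl = trans pair≡ (sym pair≡′)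
      sameLevel-injective (splitting true _ _ i j _ _ _ _ _) (splitting false _ _ .(i) _ _ _ _ _ _) refl same =
        ⊥-elim (gapCode≢offset i j _ same)
      sameLevel-injective (splitting false _ _ i _ _ _ _ _ _) (splitting true _ _ .(i) j′ _ _ _ _ _) refl same =
        ⊥-elim (gapCode≢offset i j′ _ (sym same))

  tLess-b : ∀ N → tLess b N (suc (suc (suc e) + suc (suc e)))
  tLess-b N = fewerThan-byCode _ (λ pair → code (toSplitting pair)) (λ pair → code< (toSplitting pair))
                              (λ pair pair′ → code-injective (toSplitting pair) (toSplitting pair′))

primePower-≥2 : ∀ {q} → IsPrimePower q → 2 ≤ q
primePower-≥2 (p , s , prime _ , 1≤s , refl) =
  ≤-trans (nonTrivial⇒n>1 p) (subst (_≤ p ^ s) (*-identityʳ p) (^-monoʳ-≤ p {{nonTrivial⇒nonZero p}} 1≤s))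

theorem3p3 : ∀ {c ℓ} (q : ℕ) .{{_ : NonZero q}} → IsPrimePower q →
    (R : CommutativeRing c ℓ) → IsField R →
    (ι : Fin q → CommutativeRing.Carrier R) → IsDigitBijection q R ι →
    -- ε = n / d  with n , d ≥ 1 (ε > 0 rational); b_j for j = k + 1 is b k
    (n d : ℕ) → 1 ≤ n → 1 ≤ d →
    ∃ λ (b : ℕ → ℕ) → ∃ λ (K₀ : ℕ) →
      1 ≤ K₀
      × (∀ k → b k < b (suc k))
      × (∀ N → Poly.tLess q R ι b N K₀)
      × (∃ λ (C : ℕ) → ∀ k → b k ^ d ≤ C * suc k ^ (2 * d + n))
theorem3p3 q q-primePower R _ ι (ι-injective , _ , ι-zero) n d 1≤n _ =
  b , _ , s≤s z≤n , b-strictlyIncreasing , tLess-b , (q ^ (3 * d) , b^d≤)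
  where
    2≤q = primePower-≥2 q-primePower
    open Sequence q 2≤q (2 * d) using (b; b-strictlyIncreasing)
    open Representations q 2≤q R ι ι-injective ι-zero (2 * d) using (tLess-b)
    open Growth q 2≤q d n 1≤n using (b^d≤)
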